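{- Let $A$ and $B$ be nonempty finite sets with $|A|=|B|$, and let $\ell \geq 2$. Let $\mathcal P$ and $\mathcal Q$ be partitions of $A$ and $B$, respectively, with $|\mathcal P| + |\mathcal Q| = \ell$. Then there exist a refinement $\mathcal P' = \{S_1, \ldots, S_t\}$ of $\mathcal P$ and a refinement $\mathcal Q' = \{T_1, \ldots, T_t\}$ of $\mathcal Q$ such that $t \leq \ell - 1$ and $|S_i| = |T_i|$ for every $i = 1, \ldots, t$. -}

module Defs where

open import Data.Nat using (ℕ)
open import Data.Fin using (Fin; _≟_)
open import Data.List using (length; filter)
open import Data.List.Base using (allFin)
open import Data.Product using (∃)
open import Relation.Binary.PropositionalEquality using (_≡_)

-- A partition of the finite set Fin n into exactly k (nonempty) blocks,
-- given by labelling each element with its block; block i is the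
-- preimage of i.  Surjectivity = every block is nonempty.
record Partition (n k : ℕ) : Set where
  field
    block      : Fin n → Fin k
    surjective : ∀ (i : Fin k) → ∃ λ (a : Fin n) → block a ≡ i
open Partition public

Refines : ∀ {n k k'} → Partition n k' → Partition n k → Set
Refines {n} P' P = ∀ (a b : Fin n) → block P' a ≡ block P' b → block P a ≡ block P b

blockSize : ∀ {n k} → Partition n k → Fin k → ℕ
blockSize {n} P i = length (filter (λ a → block P a ≟ i) (allFin n))

{-# OPTIONS --safe #-}
-- Permuting the ground set, every partition becomes a partition into consecutive
-- intervals, i.e. a monotone labelling of positions.  If α and β are the monotone
-- labellings obtained from P and Q, then x ↦ α x + β x is monotone as well, so it
-- determines both α x and β x; its at most (|P| - 1) + (|Q| - 1) + 1 values are
-- the common refinement of the two interval partitions.  Pulling this labelling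
-- back along the two permutations gives refinements of P and of Q whose blocks
-- with equal labels have equal sizes; discarding the empty labels makes them
-- partitions.
module Submission where

open import Defs
open import Data.Bool.Base using (true; false; if_then_else_)
open import Data.Fin as Fin using (Fin; zero; suc; toℕ; fromℕ<; punchIn; punchOut; _≟_)
open import Data.Fin.Permutation as Perm using (Permutation′; _⟨$⟩ʳ_; _⟨$⟩ˡ_)
open import Data.Fin.Properties
  using (any?; ≤-total; toℕ<n; toℕ-injective; fromℕ<-injective;
         punchOut-injective; punchOut-cong; punchOut-punchIn; punchIn-punchOut)
open import Data.List.Base using (length; filter; tabulate; allFin)
open import Data.List.Extrema.Nat using (argmin; f[argmin]≤f[xs])
open import Data.List.Membership.Propositional using (lose)
open import Data.List.Membership.Propositional.Properties using (∈-allFin)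
open import Data.List.Properties using (filter-≐; filter-some; filter-none)
import Data.List.Relation.Unary.All as All
open import Data.Nat using (ℕ; zero; suc; _+_; _∸_; _≤_; _<_; s≤s; s≤s⁻¹)
open import Data.Nat.Properties
  using (+-0-commutativeMonoid; +-suc; +-mono-≤; +-mono-<-≤; +-cancelˡ-≡;
         ≤-refl; ≤-trans; ≤-reflexive; n≤1+n; <⇒≢; m≤n⇒m<n∨m≡n)
open import Algebra.Properties.CommutativeMonoid.Sum +-0-commutativeMonoid using (sum; sum-permute)
open import Data.Product using (Σ; _×_; _,_; proj₁; proj₂; ∃; map)
open import Data.Sum using (inj₁; inj₂)
open import Data.Vec.Functional using (Vector)
open import Function using (_∘_; id)
open import Level using (0ℓ)
open import Relation.Binary.Core using (_Preserves_⟶_)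
open import Relation.Binary.PropositionalEquality
  using (_≡_; _≢_; refl; sym; trans; cong; subst₂; module ≡-Reasoning)
open import Relation.Nullary using (¬_; does; yes; no; contradiction)
open import Relation.Nullary.Decidable using (decidable-stable)
open import Relation.Unary using (Pred; Decidable; _≐_)

≤-+-≡⇒≡ : ∀ {a b c d} → a ≤ c → b ≤ d → a + b ≡ c + d → a ≡ c × b ≡ d
≤-+-≡⇒≡ {a} {b} {d = d} a≤c b≤d a+b≡c+d with m≤n⇒m<n∨m≡n a≤c
... | inj₁ a<c = contradiction a+b≡c+d (<⇒≢ (+-mono-<-≤ a<c b≤d))
... | inj₂ refl = refl , +-cancelˡ-≡ a b d a+b≡c+d

count : ∀ {N} {P : Pred (Fin N) 0ℓ} → Decidable P → ℕ
count P? = length (filter P? (allFin _))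

module _ {N : ℕ} {P : Pred (Fin N) 0ℓ} (P? : Decidable P) where

  count≡0⇒∄ : count P? ≡ 0 → ∀ a → ¬ P a
  count≡0⇒∄ count≡0 a Pa = <⇒≢ (filter-some P? (lose (∈-allFin a) Pa)) (sym count≡0)

  count≢0⇒∃ : count P? ≢ 0 → ∃ P
  count≢0⇒∃ count≢0 = decidable-stable (any? P?) λ ∄P →
    count≢0 (cong length (filter-none P? {allFin N} (All.tabulate λ {a} _ Pa → ∄P (a , Pa))))

  count-≐ : ∀ {Q : Pred (Fin N) 0ℓ} (Q? : Decidable Q) → P ≐ Q → count P? ≡ count Q?
  count-≐ Q? P≐Q = cong length (filter-≐ P? Q? P≐Q (allFin N))

length-filter-tabulate : ∀ {A : Set} {P : Pred A 0ℓ} (P? : Decidable P) {N} (f : Vector A N) →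
  length (filter P? (tabulate f)) ≡ sum (λ i → if does (P? (f i)) then 1 else 0)
length-filter-tabulate P? {zero} f = refl
length-filter-tabulate P? {suc N} f with does (P? (f zero))
... | true = cong suc (length-filter-tabulate P? (f ∘ suc))
... | false = length-filter-tabulate P? (f ∘ suc)

count-permute : ∀ {N} {P : Pred (Fin N) 0ℓ} (P? : Decidable P) (σ : Permutation′ N) →
                count (P? ∘ (σ ⟨$⟩ʳ_)) ≡ count P?
count-permute {N} P? σ = begin
  count (P? ∘ (σ ⟨$⟩ʳ_))                    ≡⟨ length-filter-tabulate (P? ∘ (σ ⟨$⟩ʳ_)) id ⟩
  sum (λ a → indicator (σ ⟨$⟩ʳ a))          ≡⟨ sum-permute indicator σ ⟨
  sum indicator                             ≡⟨ length-filter-tabulate P? id ⟨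
  count P?                                  ∎
  where
  open ≡-Reasoning
  indicator : Vector ℕ N
  indicator a = if does (P? a) then 1 else 0

fibreSize : ∀ {N t} → (Fin N → Fin t) → Fin t → ℕ
fibreSize f k = count (λ a → f a ≟ k)

Sorted : ∀ {N} → (Fin N → ℕ) → Set
Sorted f = f Preserves Fin._≤_ ⟶ _≤_

argmin-≤ : ∀ {N} (h : Fin (suc N) → ℕ) b → h (argmin h zero (allFin _)) ≤ h b
argmin-≤ h b = All.lookup (f[argmin]≤f[xs] {f = h} zero (allFin _)) (∈-allFin b)

sortingPermutation : ∀ {N} (h : Fin N → ℕ) → Σ (Permutation′ N) λ σ → Sorted (h ∘ (σ ⟨$⟩ʳ_))
sortingPermutation {zero} h = Perm.id , λ { {()} }
sortingPermutation {suc N} h = Perm.insert zero a σ , sorted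
  where
  a : Fin (suc N)
  a = argmin h zero (allFin _)
  rest : Σ (Permutation′ N) λ σ → Sorted (h ∘ punchIn a ∘ (σ ⟨$⟩ʳ_))
  rest = sortingPermutation (h ∘ punchIn a)
  σ : Permutation′ N
  σ = proj₁ rest
  sorted : Sorted (h ∘ (Perm.insert zero a σ ⟨$⟩ʳ_))
  sorted {zero} _ = argmin-≤ h _
  sorted {suc x} {suc y} (s≤s x≤y) = proj₂ rest x≤y

Sorted-+-injective : ∀ {N} {α β : Fin N → ℕ} → Sorted α → Sorted β →
                     ∀ x y → α x + β x ≡ α y + β y → α x ≡ α y × β x ≡ β y
Sorted-+-injective α↑ β↑ x y αβx≡αβy with ≤-total x y
... | inj₁ x≤y = ≤-+-≡⇒≡ (α↑ x≤y) (β↑ x≤y) αβx≡αβy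
... | inj₂ y≤x = map sym sym (≤-+-≡⇒≡ (α↑ y≤x) (β↑ y≤x) (sym αβx≡αβy))

Finer : ∀ {N} {B C : Set} → (Fin N → B) → (Fin N → C) → Set
Finer f g = ∀ a b → f a ≡ f b → g a ≡ g b

Finer-refl : ∀ {N} {B : Set} {f : Fin N → B} → Finer f f
Finer-refl _ _ = id

Finer-trans : ∀ {N} {B C D : Set} {f : Fin N → B} {g : Fin N → C} {h : Fin N → D} →
              Finer f g → Finer g h → Finer f h
Finer-trans f⊑g g⊑h a b = g⊑h a b ∘ f⊑g a b

-- For f, g = block P, block Q this unfolds to the conclusion of proposition4p2.
BalancedRefinement : ∀ {N} {B C : Set} → (Fin N → B) → (Fin N → C) → ℕ → Set
BalancedRefinement {N} f g T = Σ ℕ λ t → Σ (Partition N t) λ P' → Σ (Partition N t) λ Q' →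
  Finer (block P') f × Finer (block Q') g × t ≤ T × (∀ i → blockSize P' i ≡ blockSize Q' i)

BalancedRefinement-weaken : ∀ {N} {B B₀ C C₀ : Set} {f : Fin N → B} {f₀ : Fin N → B₀}
  {g : Fin N → C} {g₀ : Fin N → C₀} {T T₀} → Finer f f₀ → Finer g g₀ → T ≤ T₀ →
  BalancedRefinement f g T → BalancedRefinement f₀ g₀ T₀
BalancedRefinement-weaken f⊑f₀ g⊑g₀ T≤T₀ (t , P' , Q' , P'⊑f , Q'⊑g , t≤T , sizes) =
  t , P' , Q' , Finer-trans P'⊑f f⊑f₀ , Finer-trans Q'⊑g g⊑g₀ , ≤-trans t≤T T≤T₀ , sizes

module _ {N : ℕ} (σ : Permutation′ N) where

  Finer-unpermute : ∀ {B C : Set} {c : Fin N → B} {h : Fin N → C} →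
                    Finer c (h ∘ (σ ⟨$⟩ʳ_)) → Finer (c ∘ (σ ⟨$⟩ˡ_)) h
  Finer-unpermute {h = h} c⊑hσ a b cσ⁻¹a≡cσ⁻¹b =
    subst₂ (λ x y → h x ≡ h y) (Perm.inverseʳ σ) (Perm.inverseʳ σ) (c⊑hσ _ _ cσ⁻¹a≡cσ⁻¹b)

  fibreSize-unpermute : ∀ {t} (c : Fin N → Fin t) k → fibreSize (c ∘ (σ ⟨$⟩ˡ_)) k ≡ fibreSize c k
  fibreSize-unpermute c k = count-permute (λ x → c x ≟ k) (Perm.flip σ)

module _ {N t : ℕ} {k : Fin (suc t)} (f : Fin N → Fin (suc t)) (k∉f : ∀ a → f a ≢ k) where

  dropLabel : Fin N → Fin t
  dropLabel a = punchOut (k∉f a ∘ sym)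

  Finer-dropLabel : Finer dropLabel f
  Finer-dropLabel a b = punchOut-injective (k∉f a ∘ sym) (k∉f b ∘ sym)

  fibreSize-dropLabel : ∀ j → fibreSize dropLabel j ≡ fibreSize f (punchIn k j)
  fibreSize-dropLabel j = count-≐ (λ a → dropLabel a ≟ j) (λ a → f a ≟ punchIn k j)
    ( (λ {a} e → trans (sym (punchIn-punchOut (k∉f a ∘ sym))) (cong (punchIn k) e))
    , (λ {a} e → trans (punchOut-cong k e) (punchOut-punchIn k)) )

dropEmptyBlocks : ∀ {N} t (f g : Fin N → Fin t) → (∀ k → fibreSize f k ≡ fibreSize g k) →
                  BalancedRefinement f g t
dropEmptyBlocks zero f g f≈g =
  0 , record { block = f ; surjective = λ () } , record { block = g ; surjective = λ () } ,
  Finer-refl , Finer-refl , ≤-refl , f≈g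
dropEmptyBlocks (suc t) f g f≈g with any? (λ k → fibreSize f k Data.Nat.≟ 0)
... | no noneEmpty =
  suc t , record { block = f ; surjective = λ k → count≢0⇒∃ _ (noneEmpty ∘ (k ,_)) }
        , record { block = g ; surjective = λ k → count≢0⇒∃ _ (noneEmpty ∘ (k ,_) ∘ trans (f≈g k)) } ,
  Finer-refl , Finer-refl , ≤-refl , f≈g
... | yes (k , fₖ≡0) =
  BalancedRefinement-weaken (Finer-dropLabel f k∉f) (Finer-dropLabel g k∉g) (n≤1+n t)
    (dropEmptyBlocks t (dropLabel f k∉f) (dropLabel g k∉g) λ j → begin
      fibreSize (dropLabel f k∉f) j  ≡⟨ fibreSize-dropLabel f k∉f j ⟩
      fibreSize f (punchIn k j)      ≡⟨ f≈g (punchIn k j) ⟩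
      fibreSize g (punchIn k j)      ≡⟨ fibreSize-dropLabel g k∉g j ⟨
      fibreSize (dropLabel g k∉g) j  ∎)
  where
  open ≡-Reasoning
  k∉f : ∀ a → f a ≢ k
  k∉f = count≡0⇒∄ _ fₖ≡0
  k∉g : ∀ a → g a ≢ k
  k∉g = count≡0⇒∄ _ (trans (sym (f≈g k)) fₖ≡0)

balancedRefinement : ∀ {N p q} (f : Fin N → Fin (suc p)) (g : Fin N → Fin (suc q)) →
                     BalancedRefinement f g (suc (p + q))
balancedRefinement {N} {p} {q} f g =
  BalancedRefinement-weaken (Finer-unpermute σ joint⊑fσ) (Finer-unpermute τ joint⊑gτ) ≤-refl
    (dropEmptyBlocks _ (joint ∘ (σ ⟨$⟩ˡ_)) (joint ∘ (τ ⟨$⟩ˡ_)) λ k →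
      trans (fibreSize-unpermute σ joint k) (sym (fibreSize-unpermute τ joint k)))
  where
  σ τ : Permutation′ N
  σ = proj₁ (sortingPermutation (toℕ ∘ f))
  τ = proj₁ (sortingPermutation (toℕ ∘ g))
  α β : Fin N → ℕ
  α x = toℕ (f (σ ⟨$⟩ʳ x))
  β x = toℕ (g (τ ⟨$⟩ʳ x))
  α↑ : Sorted α
  α↑ = proj₂ (sortingPermutation (toℕ ∘ f))
  β↑ : Sorted β
  β↑ = proj₂ (sortingPermutation (toℕ ∘ g))
  α+β< : ∀ x → α x + β x < suc (p + q)
  α+β< x = s≤s (+-mono-≤ (s≤s⁻¹ (toℕ<n (f (σ ⟨$⟩ʳ x)))) (s≤s⁻¹ (toℕ<n (g (τ ⟨$⟩ʳ x)))))
  joint : Fin N → Fin (suc (p + q))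
  joint x = fromℕ< (α+β< x)
  joint-injective : ∀ x y → joint x ≡ joint y → α x ≡ α y × β x ≡ β y
  joint-injective x y = Sorted-+-injective α↑ β↑ x y ∘ fromℕ<-injective _ _ (α+β< x) (α+β< y)
  joint⊑fσ : Finer joint (f ∘ (σ ⟨$⟩ʳ_))
  joint⊑fσ x y = toℕ-injective ∘ proj₁ ∘ joint-injective x y
  joint⊑gτ : Finer joint (g ∘ (τ ⟨$⟩ʳ_))
  joint⊑gτ x y = toℕ-injective ∘ proj₂ ∘ joint-injective x y

proposition4p2 : (n : ℕ) → (ℓ p q : ℕ) → 2 ≤ ℓ →
    (P : Partition (suc n) p) → (Q : Partition (suc n) q) → p + q ≡ ℓ →
    Σ ℕ λ t → Σ (Partition (suc n) t) λ P' → Σ (Partition (suc n) t) λ Q' →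
    Refines P' P × Refines Q' Q × t ≤ ℓ ∸ 1 ×
    (∀ (i : Fin t) → blockSize P' i ≡ blockSize Q' i)
proposition4p2 n ℓ zero q _ P Q _ with block P zero
... | ()
proposition4p2 n ℓ (suc p) zero _ P Q _ with block Q zero
... | ()
proposition4p2 n .(suc p + suc q) (suc p) (suc q) _ P Q refl =
  BalancedRefinement-weaken Finer-refl Finer-refl (≤-reflexive (sym (+-suc p q)))
    (balancedRefinement (block P) (block Q))
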